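{- Let $t \ge 3$ be odd and let \[ Q_t(x) = 2x^{2t-1} + x^{t+1} - x^t + x^{t-1} - x^{t-2} - 2,\qquad R_t(x) = 2x^{2t-1} - x^{t+1} - 3x^t + 3x^{t-1} + x^{t-2} - 2. \] For each prime $p \ge 7$, neither $Q_t(x)$ nor $R_t(x)$ is divisible by $\Phi_p(x)$ or by $\Phi_{2p}(x)$.
   Context: $\Phi_b(x)$ denotes the $b$-th cyclotomic polynomial, $\Phi_b(x) = \prod_\zeta (x-\zeta)$ over the primitive $b$-th roots of unity $\zeta$. -}

module Defs where

open import Data.Nat as ℕ using (ℕ; zero; suc; _∸_)
open import Data.Integer as ℤ using (ℤ; +_; -_; 0ℤ; 1ℤ)
open import Data.List using (List; []; _∷_; map; replicate; _++_)
open import Data.Product using (∃)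
open import Relation.Binary.PropositionalEquality using (_≡_)

-- Polynomials with integer coefficients, as coefficient lists
-- (constant term first).  Trailing zeros are allowed; equality of
-- polynomials is coefficientwise (see coeff).
Poly : Set
Poly = List ℤ

coeff : Poly → ℕ → ℤ
coeff []       _       = 0ℤ
coeff (a ∷ _)  zero    = a
coeff (_ ∷ p)  (suc n) = coeff p n

infixl 6 _+ₚ_
infixl 7 _*ₚ_

_+ₚ_ : Poly → Poly → Poly
[]      +ₚ q       = q
(a ∷ p) +ₚ []      = a ∷ p
(a ∷ p) +ₚ (b ∷ q) = (a ℤ.+ b) ∷ (p +ₚ q)

scaleₚ : ℤ → Poly → Poly
scaleₚ c p = map (c ℤ.*_) p

_*ₚ_ : Poly → Poly → Poly
[]      *ₚ q = []
(a ∷ p) *ₚ q = scaleₚ a q +ₚ (0ℤ ∷ (p *ₚ q))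

mono : ℤ → ℕ → Poly
mono c k = replicate k 0ℤ ++ (c ∷ [])

_∣ₚ_ : Poly → Poly → Set
d ∣ₚ f = ∃ λ g → ∀ n → coeff (d *ₚ g) n ≡ coeff f n

negX : Poly → Poly
negX []      = []
negX (a ∷ p) = a ∷ map (-_) (negX p)

-- Φ_p(x) = 1 + x + ... + x^(p-1), the p-th cyclotomic polynomial for p prime
Φprime : ℕ → Poly
Φprime p = replicate p 1ℤ

-- Φ_{2p}(x) = Φ_p(-x), the 2p-th cyclotomic polynomial for p an odd prime
Φ2prime : ℕ → Poly
Φ2prime p = negX (Φprime p)

Qpoly : ℕ → Poly
Qpoly t = mono (+ 2) (2 ℕ.* t ∸ 1) +ₚ mono 1ℤ (t ℕ.+ 1) +ₚ mono (- 1ℤ) t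
        +ₚ mono 1ℤ (t ∸ 1) +ₚ mono (- 1ℤ) (t ∸ 2) +ₚ mono (- (+ 2)) 0

Rpoly : ℕ → Poly
Rpoly t = mono (+ 2) (2 ℕ.* t ∸ 1) +ₚ mono (- 1ℤ) (t ℕ.+ 1) +ₚ mono (- (+ 3)) t
        +ₚ mono (+ 3) (t ∸ 1) +ₚ mono 1ℤ (t ∸ 2) +ₚ mono (- (+ 2)) 0

{-# OPTIONS --safe #-}
module Submission where

-- If φ divides f in ℤ[x], then Σₙ wₙ fₙ = 0 for every integer sequence w annihilated by φ(E),
-- E the shift wₙ ↦ wₙ₊₁, because pairing with w turns multiplication by φ into φ(E).
-- Modulo 2, Q_t and R_t both reduce to x^(t-2) (1 + x + x² + x³), so it suffices to find such
-- a w with w_(t-2) + w_(t-1) + w_t + w_(t+1) odd.  For Φ_p take w = Δy, with y the indicator of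
-- the residue class of t + 2 modulo p: Φ_p(E) Δy = y − E^p y = 0, and the four weights
-- telescope to y_(t-2) − y_(t+2) = −1 because p ∤ 4.  For Φ_2p(x) = Φ_p(−x) take the
-- alternating twist (−1)ⁿ wₙ, which Φ_p(−E) annihilates and which agrees with w modulo 2.

open import Defs
open import Data.Nat using (ℕ; _≤_; _%_)
open import Data.Nat.Primality using (Prime)
open import Data.Product using (_×_)
open import Relation.Nullary using (¬_)
open import Relation.Binary.PropositionalEquality using (_≡_)

open import Data.Bool using (if_then_else_)
open import Data.Integer using (ℤ; +_; -_; 0ℤ; 1ℤ; -1ℤ; _+_; _-_; _*_; _^_; ∣_∣)
open import Data.Integer.Properties
  using (*-zeroʳ; +-assoc; +-identityˡ; +-identityʳ; +-inverseʳ; *-identityʳ; -1*i≡-i; abs-*)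
open import Data.Integer.Tactic.RingSolver using (solve-∀)
open import Data.List using (List; []; _∷_; map; replicate; foldl)
open import Data.Nat as ℕ using (suc; s≤s; _∸_; NonZero; _/_; _≟_)
open import Data.Nat.DivMod using (m≡m%n+[m/n]*n; [m+n]%n≡m%n)
open import Data.Nat.Divisibility using (_∣_; ∣m+n∣m⇒∣n; n∣m*n; ∣⇒≤)
import Data.Nat.Properties as ℕ
open import Data.Product using (∃; _,_)
open import Function using (_∘_)
open import Relation.Nullary.Decidable using (does; dec-true; dec-false)
open import Relation.Binary.PropositionalEquality
  using (refl; sym; trans; cong; cong₂; subst; _≢_; module ≡-Reasoning)

open ≡-Reasoning

pairing : (ℕ → ℤ) → Poly → ℤ
pairing w []      = 0ℤ
pairing w (a ∷ f) = w 0 * a + pairing (w ∘ suc) f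

pairing-cong : ∀ {u v} → (∀ n → u n ≡ v n) → ∀ f → pairing u f ≡ pairing v f
pairing-cong u≗v []      = refl
pairing-cong u≗v (a ∷ f) = cong₂ _+_ (cong (_* a) (u≗v 0)) (pairing-cong (u≗v ∘ suc) f)

pairing-zeroˡ : ∀ {w} → (∀ n → w n ≡ 0ℤ) → ∀ f → pairing w f ≡ 0ℤ
pairing-zeroˡ w≗0 []      = refl
pairing-zeroˡ w≗0 (a ∷ f) = cong₂ _+_ (cong (_* a) (w≗0 0)) (pairing-zeroˡ (w≗0 ∘ suc) f)

pairing-+ₚ : ∀ w f g → pairing w (f +ₚ g) ≡ pairing w f + pairing w g
pairing-+ₚ w []      g       = sym (+-identityˡ (pairing w g))
pairing-+ₚ w (a ∷ f) []      = sym (+-identityʳ (pairing w (a ∷ f)))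
pairing-+ₚ w (a ∷ f) (b ∷ g) = begin
  w 0 * (a + b) + pairing (w ∘ suc) (f +ₚ g)
    ≡⟨ cong (_+_ (w 0 * (a + b))) (pairing-+ₚ (w ∘ suc) f g) ⟩
  w 0 * (a + b) + (pairing (w ∘ suc) f + pairing (w ∘ suc) g)
    ≡⟨ regroup (w 0) a b (pairing (w ∘ suc) f) (pairing (w ∘ suc) g) ⟩
  w 0 * a + pairing (w ∘ suc) f + (w 0 * b + pairing (w ∘ suc) g) ∎
  where
  regroup : ∀ x a b y z → x * (a + b) + (y + z) ≡ x * a + y + (x * b + z)
  regroup = solve-∀

pairing-scaleₚ : ∀ w c f → pairing w (scaleₚ c f) ≡ c * pairing w f
pairing-scaleₚ w c []      = sym (*-zeroʳ c)
pairing-scaleₚ w c (a ∷ f) = begin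
  w 0 * (c * a) + pairing (w ∘ suc) (scaleₚ c f)
    ≡⟨ cong (_+_ (w 0 * (c * a))) (pairing-scaleₚ (w ∘ suc) c f) ⟩
  w 0 * (c * a) + c * pairing (w ∘ suc) f
    ≡⟨ regroup (w 0) c a (pairing (w ∘ suc) f) ⟩
  c * (w 0 * a + pairing (w ∘ suc) f) ∎
  where
  regroup : ∀ x c a y → x * (c * a) + c * y ≡ c * (x * a + y)
  regroup = solve-∀

pairing-linearˡ : ∀ c u v f → pairing (λ n → c * u n + v n) f ≡ c * pairing u f + pairing v f
pairing-linearˡ c u v []      = sym (trans (+-identityʳ (c * 0ℤ)) (*-zeroʳ c))
pairing-linearˡ c u v (a ∷ f) = begin
  (c * u 0 + v 0) * a + pairing (λ n → c * u (suc n) + v (suc n)) f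
    ≡⟨ cong (_+_ ((c * u 0 + v 0) * a)) (pairing-linearˡ c (u ∘ suc) (v ∘ suc) f) ⟩
  (c * u 0 + v 0) * a + (c * pairing (u ∘ suc) f + pairing (v ∘ suc) f)
    ≡⟨ regroup c (u 0) (v 0) a (pairing (u ∘ suc) f) (pairing (v ∘ suc) f) ⟩
  c * (u 0 * a + pairing (u ∘ suc) f) + (v 0 * a + pairing (v ∘ suc) f) ∎
  where
  regroup : ∀ c x y a s t → (c * x + y) * a + (c * s + t) ≡ c * (x * a + s) + (y * a + t)
  regroup = solve-∀

pairing-mono : ∀ w c k → pairing w (mono c k) ≡ w k * c
pairing-mono w c 0       = +-identityʳ (w 0 * c)
pairing-mono w c (suc k) = begin
  w 0 * 0ℤ + pairing (w ∘ suc) (mono c k)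
    ≡⟨ cong (_+ pairing (w ∘ suc) (mono c k)) (*-zeroʳ (w 0)) ⟩
  0ℤ + pairing (w ∘ suc) (mono c k)
    ≡⟨ +-identityˡ _ ⟩
  pairing (w ∘ suc) (mono c k)
    ≡⟨ pairing-mono (w ∘ suc) c k ⟩
  w (suc k) * c ∎

pairing-zeroʳ : ∀ w f → (∀ n → coeff f n ≡ 0ℤ) → pairing w f ≡ 0ℤ
pairing-zeroʳ w []      f≗0 = refl
pairing-zeroʳ w (a ∷ f) f≗0 = begin
  w 0 * a + pairing (w ∘ suc) f
    ≡⟨ cong₂ _+_ (cong (w 0 *_) (f≗0 0)) (pairing-zeroʳ (w ∘ suc) f (f≗0 ∘ suc)) ⟩
  w 0 * 0ℤ + 0ℤ                 ≡⟨ +-identityʳ (w 0 * 0ℤ) ⟩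
  w 0 * 0ℤ                      ≡⟨ *-zeroʳ (w 0) ⟩
  0ℤ                            ∎

pairing-coeff : ∀ w f g → (∀ n → coeff f n ≡ coeff g n) → pairing w f ≡ pairing w g
pairing-coeff w []      g       f≗g = sym (pairing-zeroʳ w g (sym ∘ f≗g))
pairing-coeff w (a ∷ f) []      f≗g = pairing-zeroʳ w (a ∷ f) f≗g
pairing-coeff w (a ∷ f) (b ∷ g) f≗g =
  cong₂ _+_ (cong (w 0 *_) (f≗g 0)) (pairing-coeff (w ∘ suc) f g (f≗g ∘ suc))

-- act φ w n = Σᵢ φᵢ w(n + i), that is, φ(E) applied to w.
act : Poly → (ℕ → ℤ) → ℕ → ℤ
act []      w n = 0ℤ
act (a ∷ φ) w n = a * w n + act φ w (suc n)

Annihilates : Poly → (ℕ → ℤ) → Set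
Annihilates φ w = ∀ n → act φ w n ≡ 0ℤ

act-∘suc : ∀ φ w n → act φ (w ∘ suc) n ≡ act φ w (suc n)
act-∘suc []      w n = refl
act-∘suc (a ∷ φ) w n = cong (_+_ (a * w (suc n))) (act-∘suc φ w (suc n))

pairing-*ₚ : ∀ w φ g → pairing w (φ *ₚ g) ≡ pairing (act φ w) g
pairing-*ₚ w []      g = sym (pairing-zeroˡ (λ _ → refl) g)
pairing-*ₚ w (a ∷ φ) g = begin
  pairing w (scaleₚ a g +ₚ (0ℤ ∷ φ *ₚ g))
    ≡⟨ pairing-+ₚ w (scaleₚ a g) (0ℤ ∷ φ *ₚ g) ⟩
  pairing w (scaleₚ a g) + (w 0 * 0ℤ + pairing (w ∘ suc) (φ *ₚ g))
    ≡⟨ cong₂ _+_ (pairing-scaleₚ w a g)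
                 (cong (_+ pairing (w ∘ suc) (φ *ₚ g)) (*-zeroʳ (w 0))) ⟩
  a * pairing w g + (0ℤ + pairing (w ∘ suc) (φ *ₚ g))
    ≡⟨ cong (_+_ (a * pairing w g)) (+-identityˡ _) ⟩
  a * pairing w g + pairing (w ∘ suc) (φ *ₚ g)
    ≡⟨ cong (_+_ (a * pairing w g)) (pairing-*ₚ (w ∘ suc) φ g) ⟩
  a * pairing w g + pairing (act φ (w ∘ suc)) g
    ≡⟨ cong (_+_ (a * pairing w g)) (pairing-cong (act-∘suc φ w) g) ⟩
  a * pairing w g + pairing (act φ w ∘ suc) g
    ≡⟨ pairing-linearˡ a w (act φ w ∘ suc) g ⟨
  pairing (act (a ∷ φ) w) g ∎

pairing-annihilated : ∀ φ w f → Annihilates φ w → φ ∣ₚ f → pairing w f ≡ 0ℤ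
pairing-annihilated φ w f φw≡0 (g , φg≗f) = begin
  pairing w f          ≡⟨ pairing-coeff w (φ *ₚ g) f φg≗f ⟨
  pairing w (φ *ₚ g)   ≡⟨ pairing-*ₚ w φ g ⟩
  pairing (act φ w) g  ≡⟨ pairing-zeroˡ φw≡0 g ⟩
  0ℤ                   ∎

Δ : (ℕ → ℤ) → ℕ → ℤ
Δ y n = y n - y (suc n)

act-replicate-Δ : ∀ y k n → act (replicate k 1ℤ) (Δ y) n ≡ y n - y (n ℕ.+ k)
act-replicate-Δ y 0       n = begin
  0ℤ               ≡⟨ +-inverseʳ (y n) ⟨
  y n - y n        ≡⟨ cong (λ i → y n - y i) (ℕ.+-identityʳ n) ⟨
  y n - y (n ℕ.+ 0) ∎
act-replicate-Δ y (suc k) n = begin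
  1ℤ * (y n - y (suc n)) + act (replicate k 1ℤ) (Δ y) (suc n)
    ≡⟨ cong (_+_ (1ℤ * (y n - y (suc n)))) (act-replicate-Δ y k (suc n)) ⟩
  1ℤ * (y n - y (suc n)) + (y (suc n) - y (suc n ℕ.+ k))
    ≡⟨ telescope (y n) (y (suc n)) (y (suc n ℕ.+ k)) ⟩
  y n - y (suc n ℕ.+ k)
    ≡⟨ cong (λ i → y n - y i) (ℕ.+-suc n k) ⟨
  y n - y (n ℕ.+ suc k) ∎
  where
  telescope : ∀ a b c → 1ℤ * (a - b) + (b - c) ≡ a - c
  telescope = solve-∀

Φprime-annihilates-Δ : ∀ {p y} → (∀ n → y (n ℕ.+ p) ≡ y n) → Annihilates (Φprime p) (Δ y)
Φprime-annihilates-Δ {p} {y} periodic n = begin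
  act (Φprime p) (Δ y) n ≡⟨ act-replicate-Δ y p n ⟩
  y n - y (n ℕ.+ p)     ≡⟨ cong (_-_ (y n)) (periodic n) ⟩
  y n - y n             ≡⟨ +-inverseʳ (y n) ⟩
  0ℤ                    ∎

alternate : (ℕ → ℤ) → ℕ → ℤ
alternate w n = -1ℤ ^ n * w n

act-map-neg : ∀ ψ w n → act (map -_ ψ) w n ≡ - act ψ w n
act-map-neg []      w n = refl
act-map-neg (a ∷ ψ) w n = begin
  - a * w n + act (map -_ ψ) w (suc n) ≡⟨ cong (_+_ (- a * w n)) (act-map-neg ψ w (suc n)) ⟩
  - a * w n + - act ψ w (suc n)        ≡⟨ negate a (w n) (act ψ w (suc n)) ⟩
  - (a * w n + act ψ w (suc n))        ∎
  where
  negate : ∀ a x y → - a * x + - y ≡ - (a * x + y)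
  negate = solve-∀

act-negX-alternate : ∀ φ w n → act (negX φ) (alternate w) n ≡ -1ℤ ^ n * act φ w n
act-negX-alternate []      w n = sym (*-zeroʳ (-1ℤ ^ n))
act-negX-alternate (a ∷ φ) w n = begin
  a * (s * w n) + act (map -_ (negX φ)) (alternate w) (suc n)
    ≡⟨ cong (_+_ (a * (s * w n))) (act-map-neg (negX φ) (alternate w) (suc n)) ⟩
  a * (s * w n) + - act (negX φ) (alternate w) (suc n)
    ≡⟨ cong (λ x → a * (s * w n) + - x) (act-negX-alternate φ w (suc n)) ⟩
  a * (s * w n) + - (-1ℤ * s * act φ w (suc n))
    ≡⟨ factor a s (w n) (act φ w (suc n)) ⟩
  s * (a * w n + act φ w (suc n)) ∎
  where
  s : ℤ
  s = -1ℤ ^ n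
  factor : ∀ a s x y → a * (s * x) + - (-1ℤ * s * y) ≡ s * (a * x + y)
  factor = solve-∀

negX-annihilates-alternate : ∀ {φ w} → Annihilates φ w → Annihilates (negX φ) (alternate w)
negX-annihilates-alternate {φ} {w} φw≡0 n = begin
  act (negX φ) (alternate w) n ≡⟨ act-negX-alternate φ w n ⟩
  -1ℤ ^ n * act φ w n          ≡⟨ cong (_*_ (-1ℤ ^ n)) (φw≡0 n) ⟩
  -1ℤ ^ n * 0ℤ                 ≡⟨ *-zeroʳ (-1ℤ ^ n) ⟩
  0ℤ                           ∎

Odd : ℤ → Set
Odd i = ∃ λ k → i ≡ + 2 * k + 1ℤ

odd⇒≢0 : ∀ {i} → Odd i → i ≢ 0ℤ
odd⇒≢0 (k , refl) 2k+1≡0 = ℕ.even≢odd ∣ k ∣ 0 (begin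
  2 ℕ.* ∣ k ∣  ≡⟨ abs-* (+ 2) k ⟨
  ∣ + 2 * k ∣  ≡⟨ cong ∣_∣ 2k≡-1 ⟩
  1            ∎)
  where
  cancel : ∀ a → a ≡ a + 1ℤ + -1ℤ
  cancel = solve-∀
  2k≡-1 : + 2 * k ≡ -1ℤ
  2k≡-1 = trans (cancel (+ 2 * k)) (cong (_+ -1ℤ) 2k+1≡0)

odd-+even : ∀ j {i} → Odd i → Odd (+ 2 * j + i)
odd-+even j (k , refl) = j + k , regroup j k
  where
  regroup : ∀ j k → + 2 * j + (+ 2 * k + 1ℤ) ≡ + 2 * (j + k) + 1ℤ
  regroup = solve-∀

odd-neg : ∀ {i} → Odd i → Odd (- i)
odd-neg (k , refl) = - k - 1ℤ , regroup k
  where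
  regroup : ∀ k → - (+ 2 * k + 1ℤ) ≡ + 2 * (- k - 1ℤ) + 1ℤ
  regroup = solve-∀

odd-alternating : ∀ n → Odd (-1ℤ ^ n)
odd-alternating 0       = 0ℤ , refl
odd-alternating (suc n) = subst Odd (sym (-1*i≡-i (-1ℤ ^ n))) (odd-neg (odd-alternating n))

_+mono_ : Poly → ℤ × ℕ → Poly
f +mono (c , k) = f +ₚ mono c k

weightedSum : (ℕ → ℤ) → List (ℤ × ℕ) → ℤ
weightedSum w []             = 0ℤ
weightedSum w ((c , k) ∷ ts) = w k * c + weightedSum w ts

pairing-foldl-+mono : ∀ w f ts → pairing w (foldl _+mono_ f ts) ≡ pairing w f + weightedSum w ts
pairing-foldl-+mono w f []             = sym (+-identityʳ (pairing w f))
pairing-foldl-+mono w f ((c , k) ∷ ts) = begin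
  pairing w (foldl _+mono_ (f +ₚ mono c k) ts)
    ≡⟨ pairing-foldl-+mono w (f +ₚ mono c k) ts ⟩
  pairing w (f +ₚ mono c k) + weightedSum w ts
    ≡⟨ cong (_+ weightedSum w ts) (pairing-+ₚ w f (mono c k)) ⟩
  pairing w f + pairing w (mono c k) + weightedSum w ts
    ≡⟨ cong (λ x → pairing w f + x + weightedSum w ts) (pairing-mono w c k) ⟩
  pairing w f + w k * c + weightedSum w ts
    ≡⟨ +-assoc (pairing w f) (w k * c) (weightedSum w ts) ⟩
  pairing w f + (w k * c + weightedSum w ts) ∎

middle : (ℕ → ℤ) → ℕ → ℤ
middle w m = w (3 ℕ.+ m) - w (2 ℕ.+ m) + w (1 ℕ.+ m) - w m

odd-pairing-Qpoly : ∀ w m → Odd (middle w m) → Odd (pairing w (Qpoly (2 ℕ.+ m)))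
odd-pairing-Qpoly w m odd = subst Odd (sym expansion) (odd-+even (w e - w 0) odd)
  where
  t e : ℕ
  t = 2 ℕ.+ m
  e = 2 ℕ.* t ∸ 1
  regroup : ∀ a b c d f g →
    0ℤ + (a * + 2 + (b * 1ℤ + (c * - 1ℤ + (d * 1ℤ + (f * - 1ℤ + (g * - + 2 + 0ℤ))))))
    ≡ + 2 * (a - g) + (b - c + d - f)
  regroup = solve-∀
  expansion : pairing w (Qpoly t) ≡ + 2 * (w e - w 0) + middle w m
  expansion = begin
    pairing w (Qpoly t)
      ≡⟨ pairing-foldl-+mono w [] ( (+ 2 , e) ∷ (1ℤ , t ℕ.+ 1) ∷ (- 1ℤ , t)
                                  ∷ (1ℤ , 1 ℕ.+ m) ∷ (- 1ℤ , m) ∷ (- + 2 , 0) ∷ []) ⟩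
    _
      ≡⟨ regroup (w e) (w (t ℕ.+ 1)) (w t) (w (1 ℕ.+ m)) (w m) (w 0) ⟩
    + 2 * (w e - w 0) + (w (t ℕ.+ 1) - w t + w (1 ℕ.+ m) - w m)
      ≡⟨ cong (λ i → + 2 * (w e - w 0) + (w i - w t + w (1 ℕ.+ m) - w m)) (ℕ.+-comm t 1) ⟩
    + 2 * (w e - w 0) + middle w m ∎

odd-pairing-Rpoly : ∀ w m → Odd (middle w m) → Odd (pairing w (Rpoly (2 ℕ.+ m)))
odd-pairing-Rpoly w m odd = subst Odd (sym expansion) (odd-+even even (odd-neg odd))
  where
  t e : ℕ
  t = 2 ℕ.+ m
  e = 2 ℕ.* t ∸ 1
  even : ℤ
  even = w e - w 0 - + 2 * w t + + 2 * w (1 ℕ.+ m)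
  regroup : ∀ a b c d f g →
    0ℤ + (a * + 2 + (b * - 1ℤ + (c * - + 3 + (d * + 3 + (f * 1ℤ + (g * - + 2 + 0ℤ))))))
    ≡ + 2 * (a - g - + 2 * c + + 2 * d) - (b - c + d - f)
  regroup = solve-∀
  expansion : pairing w (Rpoly t) ≡ + 2 * even - middle w m
  expansion = begin
    pairing w (Rpoly t)
      ≡⟨ pairing-foldl-+mono w [] ( (+ 2 , e) ∷ (- 1ℤ , t ℕ.+ 1) ∷ (- + 3 , t)
                                  ∷ (+ 3 , 1 ℕ.+ m) ∷ (1ℤ , m) ∷ (- + 2 , 0) ∷ []) ⟩
    _
      ≡⟨ regroup (w e) (w (t ℕ.+ 1)) (w t) (w (1 ℕ.+ m)) (w m) (w 0) ⟩
    + 2 * even - (w (t ℕ.+ 1) - w t + w (1 ℕ.+ m) - w m)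
      ≡⟨ cong (λ i → + 2 * even - (w i - w t + w (1 ℕ.+ m) - w m)) (ℕ.+-comm t 1) ⟩
    + 2 * even - middle w m ∎

odd-pairing⇒∤ : ∀ φ w f → Annihilates φ w → Odd (pairing w f) → ¬ φ ∣ₚ f
odd-pairing⇒∤ φ w f φw≡0 odd φ∣f = odd⇒≢0 odd (pairing-annihilated φ w f φw≡0 φ∣f)

odd-middle-Δ : ∀ y m → y m ≡ 0ℤ → y (4 ℕ.+ m) ≡ 1ℤ → Odd (middle (Δ y) m)
odd-middle-Δ y m y₀≡0 y₄≡1 = subst Odd (sym (begin
  middle (Δ y) m                    ≡⟨ expand (y m) (y (1 ℕ.+ m)) (y (2 ℕ.+ m)) (y (3 ℕ.+ m)) (y (4 ℕ.+ m)) ⟩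
  + 2 * even - (y (4 ℕ.+ m) + y m)  ≡⟨ cong (λ z → + 2 * even - z) (cong₂ _+_ y₄≡1 y₀≡0) ⟩
  + 2 * even - 1ℤ                   ∎))
  (odd-+even even (-1ℤ , refl))
  where
  even : ℤ
  even = y (3 ℕ.+ m) - y (2 ℕ.+ m) + y (1 ℕ.+ m)
  expand : ∀ a b c d e → (d - e) - (c - d) + (b - c) - (a - b) ≡ + 2 * (d - c + b) - (e + a)
  expand = solve-∀

odd-middle-alternate-Δ : ∀ y m → y m ≡ 0ℤ → y (4 ℕ.+ m) ≡ 1ℤ →
                         Odd (middle (alternate (Δ y)) m)
odd-middle-alternate-Δ y m y₀≡0 y₄≡1 = subst Odd (sym (begin
  middle (alternate (Δ y)) m
    ≡⟨ expand (-1ℤ ^ m) (y m) (y (1 ℕ.+ m)) (y (2 ℕ.+ m)) (y (3 ℕ.+ m)) (y (4 ℕ.+ m)) ⟩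
  -1ℤ ^ m * (y (4 ℕ.+ m) - y m)
    ≡⟨ cong (_*_ (-1ℤ ^ m)) (cong₂ _-_ y₄≡1 y₀≡0) ⟩
  -1ℤ ^ m * 1ℤ
    ≡⟨ *-identityʳ (-1ℤ ^ m) ⟩
  -1ℤ ^ m ∎))
  (odd-alternating m)
  where
  expand : ∀ s a b c d e →
    -1ℤ * (-1ℤ * (-1ℤ * s)) * (d - e) - -1ℤ * (-1ℤ * s) * (c - d)
      + -1ℤ * s * (b - c) - s * (a - b)
    ≡ s * (e - a)
  expand = solve-∀

module _ (p : ℕ) .{{_ : NonZero p}} where

  residueIndicator : ℕ → ℕ → ℤ
  residueIndicator c n = if does (n % p ≟ c % p) then 1ℤ else 0ℤ

  residueIndicator-periodic : ∀ c n → residueIndicator c (n ℕ.+ p) ≡ residueIndicator c n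
  residueIndicator-periodic c n =
    cong (λ r → if does (r ≟ c % p) then 1ℤ else 0ℤ) ([m+n]%n≡m%n n p)

  residueIndicator-self : ∀ c → residueIndicator c c ≡ 1ℤ
  residueIndicator-self c = cong (if_then 1ℤ else 0ℤ) (dec-true (c % p ≟ c % p) refl)

  residueIndicator-other : ∀ c n → n % p ≢ c % p → residueIndicator c n ≡ 0ℤ
  residueIndicator-other c n n≢c = cong (if_then 1ℤ else 0ℤ) (dec-false (n % p ≟ c % p) n≢c)

  %-≡-+⇒∣ : ∀ k m → m % p ≡ (k ℕ.+ m) % p → p ∣ k
  %-≡-+⇒∣ k m eq =
    ∣m+n∣m⇒∣n (subst (p ∣_) quotients (n∣m*n ((k ℕ.+ m) / p))) (n∣m*n (m / p))
    where
    quotients : (k ℕ.+ m) / p ℕ.* p ≡ m / p ℕ.* p ℕ.+ k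
    quotients = ℕ.+-cancelˡ-≡ (m % p) _ _ (begin
      m % p ℕ.+ (k ℕ.+ m) / p ℕ.* p          ≡⟨ cong (ℕ._+ (k ℕ.+ m) / p ℕ.* p) eq ⟩
      (k ℕ.+ m) % p ℕ.+ (k ℕ.+ m) / p ℕ.* p  ≡⟨ m≡m%n+[m/n]*n (k ℕ.+ m) p ⟨
      k ℕ.+ m                                ≡⟨ cong (k ℕ.+_) (m≡m%n+[m/n]*n m p) ⟩
      k ℕ.+ (m % p ℕ.+ m / p ℕ.* p)          ≡⟨ ℕ.+-comm k _ ⟩
      m % p ℕ.+ m / p ℕ.* p ℕ.+ k            ≡⟨ ℕ.+-assoc (m % p) _ k ⟩
      m % p ℕ.+ (m / p ℕ.* p ℕ.+ k)          ∎)

lemma9 : (t p : ℕ) → 3 ≤ t → t % 2 ≡ 1 → Prime p → 7 ≤ p →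
    (¬ (Φprime p ∣ₚ Qpoly t)) × (¬ (Φ2prime p ∣ₚ Qpoly t)) ×
    (¬ (Φprime p ∣ₚ Rpoly t)) × (¬ (Φ2prime p ∣ₚ Rpoly t))
lemma9 0             _         ()
lemma9 1             _         (s≤s ())
lemma9 (suc (suc m)) 0         _ _ _ ()
lemma9 (suc (suc m)) p@(suc _) _ _ _ 7≤p =
    odd-pairing⇒∤ (Φprime p)  w (Qpoly (2 ℕ.+ m)) w-annihilated (odd-pairing-Qpoly w m w-odd)
  , odd-pairing⇒∤ (Φ2prime p) w̃ (Qpoly (2 ℕ.+ m)) w̃-annihilated (odd-pairing-Qpoly w̃ m w̃-odd)
  , odd-pairing⇒∤ (Φprime p)  w (Rpoly (2 ℕ.+ m)) w-annihilated (odd-pairing-Rpoly w m w-odd)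
  , odd-pairing⇒∤ (Φ2prime p) w̃ (Rpoly (2 ℕ.+ m)) w̃-annihilated (odd-pairing-Rpoly w̃ m w̃-odd)
  where
  y : ℕ → ℤ
  y = residueIndicator p (4 ℕ.+ m)
  y₀≡0 : y m ≡ 0ℤ
  y₀≡0 = residueIndicator-other p (4 ℕ.+ m) m
           (λ eq → ℕ.<⇒≱ (ℕ.≤-trans (ℕ.m≤m+n 5 2) 7≤p) (∣⇒≤ (%-≡-+⇒∣ p 4 m eq)))
  y₄≡1 : y (4 ℕ.+ m) ≡ 1ℤ
  y₄≡1 = residueIndicator-self p (4 ℕ.+ m)
  w w̃ : ℕ → ℤ
  w = Δ y
  w̃ = alternate w
  w-annihilated : Annihilates (Φprime p) w
  w-annihilated = Φprime-annihilates-Δ (residueIndicator-periodic p (4 ℕ.+ m))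
  w̃-annihilated : Annihilates (Φ2prime p) w̃
  w̃-annihilated = negX-annihilates-alternate {Φprime p} {w} w-annihilated
  w-odd : Odd (middle w m)
  w-odd = odd-middle-Δ y m y₀≡0 y₄≡1
  w̃-odd : Odd (middle w̃ m)
  w̃-odd = odd-middle-alternate-Δ y m y₀≡0 y₄≡1
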